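{- Let $S$ be the oriented graph with vertex set $\{u_1,u_2,u_3,u_4,u_5\}$ and edge set $\{u_1u_2, u_1u_3, u_2u_3, u_2u_4, u_3u_4, u_3u_5, u_4u_1, u_5u_2\}$ (where $uv$ denotes the edge oriented from $u$ to $v$). Then $S$ is Tur\'anable and $S$ is not a subgraph of $D_s$ for any $s \in \mathbb{N}$.
   Context: An oriented graph is a loopless directed graph with at most one of $uv$, $vu$ for each pair of distinct vertices; a tournament has exactly one. A regular tournament is a tournament on an odd number $n$ of vertices in which every vertex has in- and out-degree $(n-1)/2$. An oriented graph $H$ is Tur\'anable if there exists $n_0$ such that every regular tournament on $n\ge n_0$ vertices contains a copy of $H$. For $s\ge1$, $D_s$ is the tournament on $3s$ vertices whose vertex set is partitioned into three sets $A,B,C$ of size $s$, each inducing a transitive tournament, with all edges between distinct parts oriented from $A$ to $B$, from $B$ to $C$, and from $C$ to $A$. -}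

module Defs where

open import Data.Nat using (ℕ; zero; suc; _+_; _*_; _≤_; _<_; _<ᵇ_)
open import Data.Nat.ListAction using (sum)
open import Data.Fin using (Fin; zero; suc; toℕ)
open import Data.List using (List; map; allFin)
open import Data.Bool using (Bool; true; false; if_then_else_; not)
open import Data.Product using (Σ; _×_; ∃-syntax)
open import Relation.Binary.PropositionalEquality using (_≡_; _≢_)
open import Function.Definitions using (Injective)

-- A (loopless) directed graph on vertex type V, given by a Boolean adjacency
-- relation: E u v ≡ true means there is an edge oriented from u to v.
Digraph : Set → Set
Digraph V = V → V → Bool

IsOriented : {V : Set} → Digraph V → Set
IsOriented {V} E = (∀ v → E v v ≡ false) × (∀ u v → E u v ≡ true → E v u ≡ false)

IsTournament : {n : ℕ} → Digraph (Fin n) → Set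
IsTournament {n} T = (∀ v → T v v ≡ false) × (∀ u v → u ≢ v → T u v ≡ not (T v u))

private
  ind : Bool → ℕ
  ind true = 1
  ind false = 0

outdeg : {n : ℕ} → Digraph (Fin n) → Fin n → ℕ
outdeg {n} T v = sum (map (λ w → ind (T v w)) (allFin n))

indeg : {n : ℕ} → Digraph (Fin n) → Fin n → ℕ
indeg {n} T v = sum (map (λ w → ind (T w v)) (allFin n))

IsRegularTournament : {n : ℕ} → Digraph (Fin n) → Set
IsRegularTournament {n} T =
  IsTournament T × (∃[ k ] (n ≡ suc (2 * k) × (∀ v → outdeg T v ≡ k × indeg T v ≡ k)))

ContainsCopy : {m : ℕ} {V : Set} → Digraph V → Digraph (Fin m) → Set
ContainsCopy {m} {V} G H =
  Σ (Fin m → V) λ f → Injective _≡_ _≡_ f × (∀ u v → H u v ≡ true → G (f u) (f v) ≡ true)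

Turanable : {m : ℕ} → Digraph (Fin m) → Set
Turanable H = ∃[ n₀ ] (∀ n → n₀ ≤ n → (T : Digraph (Fin n)) → IsRegularTournament T → ContainsCopy T H)

-- D_s on the vertex set Fin 3 × Fin s (3s vertices): part (a , i).
-- Inside each part, transitive tournament (i, j) edge iff i < j;
-- between parts: A=0 → B=1 → C=2 → A=0.
D : (s : ℕ) → Digraph (Fin 3 × Fin s)
D s (a Data.Product., i) (b Data.Product., j) = edge a b
  where
  edge : Fin 3 → Fin 3 → Bool
  edge zero zero = toℕ i <ᵇ toℕ j
  edge (suc zero) (suc zero) = toℕ i <ᵇ toℕ j
  edge (suc (suc zero)) (suc (suc zero)) = toℕ i <ᵇ toℕ j
  edge zero (suc zero) = true
  edge (suc zero) (suc (suc zero)) = true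
  edge (suc (suc zero)) zero = true
  edge _ _ = false

-- The oriented graph S on u₁..u₅ (indices 0..4), edges
-- u1u2, u1u3, u2u3, u2u4, u3u4, u3u5, u4u1, u5u2.
S : Digraph (Fin 5)
S zero (suc zero) = true
S zero (suc (suc zero)) = true
S (suc zero) (suc (suc zero)) = true
S (suc zero) (suc (suc (suc zero))) = true
S (suc (suc zero)) (suc (suc (suc zero))) = true
S (suc (suc zero)) (suc (suc (suc (suc zero)))) = true
S (suc (suc (suc zero))) zero = true
S (suc (suc (suc (suc zero)))) (suc zero) = true
S _ _ = false

{-# OPTIONS --safe #-}
-- In a regular tournament on 2k + 1 vertices, for an edge x → y the k out-neighbours
-- of y and the k in-neighbours of x avoid x and y, so they meet: every edge lies on a
-- cyclic triangle.  Take a cyclic triangle a → b → c → a and, as k ≥ 2, an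
-- out-neighbour y ≠ b of a.  A case analysis on y and on the third vertex z of a
-- cyclic triangle through a → y yields the strong four-vertex tournament u₁u₂u₃u₄
-- of S, and a cyclic triangle through its edge u₂ → u₃ supplies u₅.
-- In D_s an edge either stays inside a part, where indices increase, or moves to the
-- next part, so a cyclic triangle visits A, B, C in cyclic order.  The triangles
-- u₁u₂u₄, u₁u₃u₄ and u₂u₃u₅ of S would put u₃ both in the part of u₂ and in the next.
module Submission where

open import Defs
open import Data.Nat using (ℕ; _≤_)
open import Data.Product using (_×_)
open import Relation.Nullary using (¬_)

open import Data.Bool using (Bool; true; false; not; _∨_)
open import Data.Bool.Properties using (T-≡) renaming (_≟_ to _≟ᵇ_)
open import Data.Empty using (⊥-elim)
open import Data.Fin using (Fin; zero; suc; toℕ; #_)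
open import Data.Fin.Properties using (all?; suc-injective) renaming (_≟_ to _≟ᶠ_)
open import Data.List using (List; []; _∷_; tabulate)
import Data.List.Membership.DecPropositional as DecMembership
open import Data.List.Membership.Propositional using (_∈_)
open import Data.List.Properties using (map-tabulate)
open import Data.List.Relation.Unary.All as All using (All; []; _∷_)
open import Data.Nat using (zero; suc; _+_; _*_; _<_; _<ᵇ_; z≤n; s≤s; s≤s⁻¹)
open import Data.Nat.ListAction using (sum)
open import Data.Nat.Properties using (+-identityʳ; +-suc; m≤n⇒m≤1+n; <⇒≤; <ᵇ⇒<; <-irrefl; <-trans)
open import Data.Product using (_,_; proj₁; proj₂; map; ∃-syntax)
open import Data.Product.Properties using (≡-dec)
open import Data.Sum using (_⊎_; inj₁; inj₂)
open import Data.Vec using (Vec; []; _∷_; lookup)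
open import Data.Vec.Relation.Unary.All using ([]; _∷_)
open import Data.Vec.Relation.Unary.Unique.Propositional using (Unique; []; _∷_)
open import Data.Vec.Relation.Unary.Unique.Propositional.Properties using (lookup-injective)
open import Function using (_∘_; id)
open import Function.Bundles using (Equivalence)
open import Relation.Binary.PropositionalEquality
  using (_≡_; _≢_; refl; sym; trans; cong; cong₂; subst; subst₂)
open import Relation.Nullary.Decidable using (toWitness; _→-dec_)

indicator : Bool → ℕ
indicator true = 1
indicator false = 0

count : ∀ {n} → (Fin n → Bool) → ℕ
count {zero} p = 0
count {suc n} p = indicator (p zero) + count (p ∘ suc)

sum-tabulate≡count : ∀ {n} {g : Fin n → ℕ} (p : Fin n → Bool) →
                     (∀ w → g w ≡ indicator (p w)) → sum (tabulate g) ≡ count p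
sum-tabulate≡count {zero} p g≗ = refl
sum-tabulate≡count {suc n} p g≗ = cong₂ _+_ (g≗ zero) (sum-tabulate≡count (p ∘ suc) (g≗ ∘ suc))

-- The indicator inside `outdeg` and `indeg` is private to Defs; the one-vertex
-- digraph exposes it.
outdeg-singleton : ∀ b → outdeg {1} (λ _ _ → b) zero ≡ indicator b
outdeg-singleton true = refl
outdeg-singleton false = refl

outdeg≡count : ∀ {n} (G : Digraph (Fin n)) v → outdeg G v ≡ count (G v)
outdeg≡count {n} G v = trans (cong sum (map-tabulate {n = n} id _))
  (sum-tabulate≡count (G v) λ w → trans (sym (+-identityʳ _)) (outdeg-singleton (G v w)))

indeg≡count : ∀ {n} (G : Digraph (Fin n)) v → indeg G v ≡ count (λ w → G w v)
indeg≡count {n} G v = trans (cong sum (map-tabulate {n = n} id _))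
  (sum-tabulate≡count (λ w → G w v) λ w → trans (sym (+-identityʳ _)) (outdeg-singleton (G w v)))

count≤n : ∀ {n} (p : Fin n → Bool) → count p ≤ n
count≤n {zero} p = z≤n
count≤n {suc n} p with p zero
... | true  = s≤s (count≤n (p ∘ suc))
... | false = m≤n⇒m≤1+n (count≤n (p ∘ suc))

count<n : ∀ {n} (p : Fin n → Bool) {x} → p x ≡ false → count p < n
count<n {suc n} p {zero} px rewrite px = s≤s (count≤n (p ∘ suc))
count<n {suc n} p {suc x} px with p zero
... | true  = s≤s (count<n (p ∘ suc) px)
... | false = m≤n⇒m≤1+n (count<n (p ∘ suc) px)

2+count≤n : ∀ {n} (p : Fin n → Bool) {x y} → x ≢ y → p x ≡ false → p y ≡ false → 2 + count p ≤ n
2+count≤n p {zero} {zero} x≢y _ _ = ⊥-elim (x≢y refl)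
2+count≤n {suc n} p {zero} {suc y} _ px py rewrite px = s≤s (count<n (p ∘ suc) py)
2+count≤n {suc n} p {suc x} {zero} _ px py rewrite py = s≤s (count<n (p ∘ suc) px)
2+count≤n {suc n} p {suc x} {suc y} x≢y px py with p zero
... | true  = s≤s (2+count≤n (p ∘ suc) (x≢y ∘ cong suc) px py)
... | false = m≤n⇒m≤1+n (2+count≤n (p ∘ suc) (x≢y ∘ cong suc) px py)

0<count⇒∃ : ∀ {n} (p : Fin n → Bool) → 0 < count p → ∃[ w ] p w ≡ true
0<count⇒∃ {suc n} p pos with p zero in p0
... | true  = zero , p0
... | false = let (w , pw) = 0<count⇒∃ (p ∘ suc) pos in suc w , pw

2≤count⇒∃≢ : ∀ {n} (p : Fin n → Bool) → 2 ≤ count p → ∀ b → ∃[ w ] (p w ≡ true × w ≢ b)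
2≤count⇒∃≢ {suc n} p two zero with p zero
... | true  = let (w , pw) = 0<count⇒∃ (p ∘ suc) (s≤s⁻¹ two) in suc w , pw , λ ()
... | false = let (w , pw) = 0<count⇒∃ (p ∘ suc) (<⇒≤ two) in suc w , pw , λ ()
2≤count⇒∃≢ {suc n} p two (suc b) with p zero in p0
... | true  = zero , p0 , λ ()
... | false = let (w , pw , w≢b) = 2≤count⇒∃≢ (p ∘ suc) two b in suc w , pw , w≢b ∘ suc-injective

pigeonhole : ∀ {n} (p q : Fin n → Bool) → count (λ w → p w ∨ q w) < count p + count q →
             ∃[ w ] (p w ≡ true × q w ≡ true)
pigeonhole {suc n} p q lt with p zero in p0 | q zero in q0
... | true  | true  = zero , p0 , q0
... | true  | false = map suc id (pigeonhole (p ∘ suc) (q ∘ suc) (s≤s⁻¹ lt))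
... | false | true  = map suc id (pigeonhole (p ∘ suc) (q ∘ suc)
                        (s≤s⁻¹ (subst (2 + count (λ w → p (suc w) ∨ q (suc w)) ≤_) (+-suc _ _) lt)))
... | false | false = map suc id (pigeonhole (p ∘ suc) (q ∘ suc) lt)

module Tournament {n} {T : Digraph (Fin n)} (tournament : IsTournament T) where

  loop-free : ∀ v → T v v ≡ false
  loop-free = proj₁ tournament

  edge⇒≢ : ∀ {u v} → T u v ≡ true → u ≢ v
  edge⇒≢ {u} uv refl with trans (sym uv) (loop-free u)
  ... | ()

  edge⇒reverse-false : ∀ {u v} → T u v ≡ true → T v u ≡ false
  edge⇒reverse-false {u} {v} uv = trans (proj₂ tournament v u (edge⇒≢ uv ∘ sym)) (cong not uv)

  edge-edge⇒≢ : ∀ {u v w} → T u v ≡ true → T v w ≡ true → w ≢ u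
  edge-edge⇒≢ uv vw refl with trans (sym vw) (edge⇒reverse-false uv)
  ... | ()

  edge-total : ∀ {u v} → u ≢ v → T u v ≡ true ⊎ T v u ≡ true
  edge-total {u} {v} u≢v with T v u in vu
  ... | true  = inj₂ refl
  ... | false = inj₁ (trans (proj₂ tournament u v u≢v) (cong not vu))

EdgesOnCyclicTriangles : ∀ {V : Set} → Digraph V → Set
EdgesOnCyclicTriangles T = ∀ {x y} → T x y ≡ true → ∃[ z ] (T y z ≡ true × T z x ≡ true)

regular-edgesOnCyclicTriangles : ∀ {n} {T : Digraph (Fin n)} → IsRegularTournament T →
                                 EdgesOnCyclicTriangles T
regular-edgesOnCyclicTriangles {n} {T} (tournament , k , n≡1+2k , degree) {x} {y} xy =
  pigeonhole (T y) (λ w → T w x) (subst₂ (λ a b → count r < a + b) out-y in-x (s≤s⁻¹ r-small))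
  where
  open Tournament tournament
  r : Fin n → Bool
  r w = T y w ∨ T w x
  r-small : 2 + count r ≤ suc (k + k)
  r-small = subst (2 + count r ≤_) (trans n≡1+2k (cong (λ m → suc (k + m)) (+-identityʳ k)))
    (2+count≤n r (edge⇒≢ xy) (cong₂ _∨_ (edge⇒reverse-false xy) (loop-free x))
                             (cong₂ _∨_ (loop-free y) (edge⇒reverse-false xy)))
  out-y : k ≡ count (T y)
  out-y = trans (sym (proj₁ (degree y))) (outdeg≡count T y)
  in-x : k ≡ count (λ w → T w x)
  in-x = trans (sym (proj₂ (degree x))) (indeg≡count T x)

copy-from-edge-list : ∀ {m} {V : Set} {G : Digraph V} {H : Digraph (Fin m)}
                      (edges : List (Fin m × Fin m)) → (∀ u v → H u v ≡ true → (u , v) ∈ edges) →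
                      (ps : Vec V m) → Unique ps →
                      All (λ (u , v) → G (lookup ps u) (lookup ps v) ≡ true) edges → ContainsCopy G H
copy-from-edge-list edges complete ps distinct preserved =
  lookup ps , (λ {u} {v} → lookup-injective distinct u v) ,
  λ u v uv → All.lookup preserved (complete u v uv)

S-edges : List (Fin 5 × Fin 5)
S-edges = (# 0 , # 1) ∷ (# 0 , # 2) ∷ (# 1 , # 2) ∷ (# 1 , # 3) ∷
          (# 2 , # 3) ∷ (# 2 , # 4) ∷ (# 3 , # 0) ∷ (# 4 , # 1) ∷ []

S-edge⇒∈ : ∀ u v → S u v ≡ true → (u , v) ∈ S-edges
S-edge⇒∈ = toWitness {a? = all? λ u → all? λ v → (S u v ≟ᵇ true) →-dec ((u , v) ∈? S-edges)} _
  where open DecMembership (≡-dec _≟ᶠ_ _≟ᶠ_)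

module Embedding {n} {T : Digraph (Fin n)} (tournament : IsTournament T)
                 (triangles : EdgesOnCyclicTriangles T) where
  open Tournament tournament

  S-from-strong-four : ∀ {p₁ p₂ p₃ p₄} → T p₁ p₂ ≡ true → T p₁ p₃ ≡ true → T p₂ p₃ ≡ true →
                       T p₂ p₄ ≡ true → T p₃ p₄ ≡ true → T p₄ p₁ ≡ true → ContainsCopy T S
  S-from-strong-four {p₁} {p₂} {p₃} {p₄} e₁₂ e₁₃ e₂₃ e₂₄ e₃₄ e₄₁ =
    let (p₅ , e₃₅ , e₅₂) = triangles e₂₃ in
    copy-from-edge-list S-edges S-edge⇒∈ (p₁ ∷ p₂ ∷ p₃ ∷ p₄ ∷ p₅ ∷ [])
      ( (edge⇒≢ e₁₂ ∷ edge⇒≢ e₁₃ ∷ edge⇒≢ e₄₁ ∘ sym ∷ edge-edge⇒≢ e₁₃ e₃₅ ∘ sym ∷ [])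
      ∷ (edge⇒≢ e₂₃ ∷ edge⇒≢ e₂₄ ∷ edge⇒≢ e₅₂ ∘ sym ∷ [])
      ∷ (edge⇒≢ e₃₄ ∷ edge⇒≢ e₃₅ ∷ [])
      ∷ (edge-edge⇒≢ e₅₂ e₂₄ ∷ [])
      ∷ [] ∷ [])
      (e₁₂ ∷ e₁₃ ∷ e₂₃ ∷ e₂₄ ∷ e₃₄ ∷ e₃₅ ∷ e₄₁ ∷ e₅₂ ∷ [])

  S-from-subdividing-vertex : ∀ {a b c w} → T a b ≡ true → T b c ≡ true → T c a ≡ true →
                              T a w ≡ true → T w b ≡ true → ContainsCopy T S
  S-from-subdividing-vertex ab bc ca aw wb with edge-total (edge-edge⇒≢ ca aw)
  ... | inj₁ wc = S-from-strong-four aw ab wb wc bc ca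
  ... | inj₂ cw = S-from-strong-four ca cw aw ab wb bc

  -- Unless y or z subdivides an edge of the triangle, y is dominated by all of it
  -- and z dominates all of it, and then z a b y is the strong four-vertex tournament.
  S-from-cyclic-triangle : ∀ {a b c} → 2 ≤ outdeg T a → T a b ≡ true → T b c ≡ true → T c a ≡ true →
                           ContainsCopy T S
  S-from-cyclic-triangle {a} {b} deg ab bc ca
    with 2≤count⇒∃≢ (T a) (subst (2 ≤_) (outdeg≡count T a) deg) b
  ... | y , ay , y≢b with edge-total y≢b
  ...   | inj₁ yb = S-from-subdividing-vertex ab bc ca ay yb
  ...   | inj₂ by with edge-total (edge-edge⇒≢ ca ay)
  ...     | inj₁ yc = S-from-subdividing-vertex bc ca ab by yc
  ...     | inj₂ cy with triangles ay
  ...       | z , yz , za with edge-total (edge-edge⇒≢ za ab ∘ sym)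
  ...         | inj₁ zb = S-from-strong-four za zb ab ay by yz
  ...         | inj₂ bz with edge-total (edge-edge⇒≢ cy yz)
  ...           | inj₁ zc = S-from-subdividing-vertex bc ca ab bz zc
  ...           | inj₂ cz = S-from-subdividing-vertex ca ab bc cz za

  contains-S : ∀ v → 2 ≤ outdeg T v → ContainsCopy T S
  contains-S v deg with 0<count⇒∃ (T v) (<⇒≤ (subst (2 ≤_) (outdeg≡count T v) deg))
  ... | y , vy with triangles vy
  ...   | z , yz , zv = S-from-cyclic-triangle deg vy yz zv

5≤1+2k⇒2≤k : ∀ k → 5 ≤ suc (2 * k) → 2 ≤ k
5≤1+2k⇒2≤k zero (s≤s ())
5≤1+2k⇒2≤k (suc zero) (s≤s (s≤s (s≤s ())))
5≤1+2k⇒2≤k (suc (suc k)) _ = s≤s (s≤s z≤n)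

regular-contains-S : ∀ n → 5 ≤ n → (T : Digraph (Fin n)) → IsRegularTournament T → ContainsCopy T S
regular-contains-S (suc n) 5≤n T regular@(tournament , k , n≡1+2k , degree) =
  Embedding.contains-S tournament (regular-edgesOnCyclicTriangles regular) zero
    (subst (2 ≤_) (sym (proj₁ (degree zero))) (5≤1+2k⇒2≤k k (subst (5 ≤_) n≡1+2k 5≤n)))

next : Fin 3 → Fin 3
next zero = # 1
next (suc zero) = # 2
next (suc (suc zero)) = # 0

next≢id : ∀ a → next a ≢ a
next≢id zero ()
next≢id (suc zero) ()
next≢id (suc (suc zero)) ()

next²≢id : ∀ a → next (next a) ≢ a
next²≢id zero ()
next²≢id (suc zero) ()
next²≢id (suc (suc zero)) ()

<ᵇ-true⇒< : ∀ {m n} → (m <ᵇ n) ≡ true → m < n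
<ᵇ-true⇒< {m} {n} m<ᵇn = <ᵇ⇒< m n (Equivalence.from T-≡ m<ᵇn)

D-edge : ∀ {s} a b {i j : Fin s} → D s (a , i) (b , j) ≡ true → (b ≡ a × toℕ i < toℕ j) ⊎ b ≡ next a
D-edge zero zero e = inj₁ (refl , <ᵇ-true⇒< e)
D-edge zero (suc zero) _ = inj₂ refl
D-edge zero (suc (suc zero)) ()
D-edge (suc zero) zero ()
D-edge (suc zero) (suc zero) e = inj₁ (refl , <ᵇ-true⇒< e)
D-edge (suc zero) (suc (suc zero)) _ = inj₂ refl
D-edge (suc (suc zero)) zero _ = inj₂ refl
D-edge (suc (suc zero)) (suc zero) ()
D-edge (suc (suc zero)) (suc (suc zero)) e = inj₁ (refl , <ᵇ-true⇒< e)

D-cyclic-triangle : ∀ {s} {x y z : Fin 3 × Fin s} → D s x y ≡ true → D s y z ≡ true → D s z x ≡ true →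
                    proj₁ y ≡ next (proj₁ x)
D-cyclic-triangle {x = a , _} {b , _} {c , _} xy yz zx
  with D-edge a b xy | D-edge b c yz | D-edge c a zx
... | inj₂ b≡next-a     | _                 | _                   = b≡next-a
... | inj₁ (refl , i<j) | inj₁ (refl , j<l) | inj₁ (_ , l<i)      =
  ⊥-elim (<-irrefl refl (<-trans i<j (<-trans j<l l<i)))
... | inj₁ (refl , _)   | inj₁ (refl , _)   | inj₂ a≡next-a       = ⊥-elim (next≢id a (sym a≡next-a))
... | inj₁ (refl , _)   | inj₂ refl         | inj₁ (a≡next-a , _) = ⊥-elim (next≢id a (sym a≡next-a))
... | inj₁ (refl , _)   | inj₂ refl         | inj₂ a≡next²a       = ⊥-elim (next²≢id a (sym a≡next²a))

D-excludes-S : ∀ s → ¬ ContainsCopy (D s) S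
D-excludes-S s (f , _ , edge) =
  next≢id (part (# 1)) (trans (sym u₃-after-u₂) (trans u₃-after-u₁ (sym u₂-after-u₁)))
  where
  part : Fin 5 → Fin 3
  part = proj₁ ∘ f
  u₂-after-u₁ : part (# 1) ≡ next (part (# 0))
  u₂-after-u₁ = D-cyclic-triangle (edge (# 0) (# 1) refl) (edge (# 1) (# 3) refl) (edge (# 3) (# 0) refl)
  u₃-after-u₁ : part (# 2) ≡ next (part (# 0))
  u₃-after-u₁ = D-cyclic-triangle (edge (# 0) (# 2) refl) (edge (# 2) (# 3) refl) (edge (# 3) (# 0) refl)
  u₃-after-u₂ : part (# 2) ≡ next (part (# 1))
  u₃-after-u₂ = D-cyclic-triangle (edge (# 1) (# 2) refl) (edge (# 2) (# 4) refl) (edge (# 4) (# 1) refl)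

proposition2p1 : Turanable S × (∀ (s : ℕ) → 1 ≤ s → ¬ ContainsCopy (D s) S)
proposition2p1 = (5 , regular-contains-S) , λ s _ → D-excludes-S s
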